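{- Let $\phi$ be a homogeneous $\textsc{3-xor}$ formula over the variables $X_1,\ldots,X_n$ (in this fixed order) with $m$ pairwise inequivalent clauses, and let $G_\phi$ be the graph constructed from $\phi$ as described in the context. Then $\phi$ is uniquely satisfiable if, and only if, $G_\phi$ is asymmetric.
   Context: Graphs are finite, simple, undirected and loopless. A $\textsc{3-xor}$ formula is a finite set of clauses, each consisting of exactly three literals on three distinct variables (a literal is a variable $X$ or its negation $\bar X$); an assignment satisfies a clause if an even number of its literals is true. Equivalently each clause is a linear equation $x+y+z=c$ over $\mathbb{F}_2$, where $c$ is $1$ iff an odd number of literals are negated; two clauses are equivalent if they give the same equation. A formula is homogeneous if no literal is negated; it is then satisfied by the all-zero assignment, and it is uniquely satisfiable if the all-zero assignment is its only satisfying assignment. Construction of $G_\phi$: for each clause $C$, whose variables listed in increasing index order are called first, second and third, let $C_{000}=C$, and let $C_{011}$, $C_{110}$, $C_{101}$ be the clauses obtained from $C$ by negating respectively the second and third, the first and second, and the first and third literals. $G_\phi$ has one vertex for each of $C_{000},C_{011},C_{110},C_{101}$ for each clause $C$; two vertices $X^0,X^1$ for each variable $X$; and three vertices $i_l,i_r,i_s$ for each $1\le i<n$. Edges: a clause vertex $D$ is adjacent to $X^1$ if the literal $X$ occurs in $D$ and to $X^0$ if the literal $\bar X$ occurs in $D$; $X^0$ is adjacent to $X^1$ for every variable $X$; and for each $1\le i<n$ there are edges $\{i_l,i_r\}$, $\{i_r,i_s\}$, $\{i_l,X_i^0\}$, $\{i_l,X_i^1\}$, $\{i_r,X_{i+1}^0\}$,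 $\{i_r,X_{i+1}^1\}$. A graph is asymmetric if its only automorphism is the identity. -}

module Defs where

open import Data.Nat using (ℕ; zero; suc; pred)
open import Data.Fin using (Fin; zero; suc; inject₁; _<_)
open import Data.Bool using (Bool; true; false; not; _xor_)
open import Data.Product using (_×_; _,_)
open import Data.Sum using (_⊎_)
open import Relation.Binary.PropositionalEquality using (_≡_)
open import Function.Bundles using (_↔_; _⇔_; Inverse)

-- Variables X₁,…,Xₙ are represented by Fin n, X_{i} ↦ index i-1 (order preserved). Since a clause is a
-- set of literals, we store it canonically with its variables in increasing index
-- order (first < second < third). The Bool sᵢ says whether the i-th literal is negated.
record Clause (n : ℕ) : Set where
  constructor clause
  field
    v₁ v₂ v₃ : Fin n
    s₁ s₂ s₃ : Bool
    v₁<v₂ : v₁ < v₂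
    v₂<v₃ : v₂ < v₃
open Clause public

Formula : ℕ → ℕ → Set
Formula n m = Fin m → Clause n

-- Each clause is the equation x + y + z = c over F₂, c = parity of negations.
rhs : ∀ {n} → Clause n → Bool
rhs C = (s₁ C xor s₂ C) xor s₃ C

-- Equivalent clauses: same equation (same variable set, same right-hand side).
Equivalent : ∀ {n} → Clause n → Clause n → Set
Equivalent C D = (v₁ C ≡ v₁ D) × (v₂ C ≡ v₂ D) × (v₃ C ≡ v₃ D) × (rhs C ≡ rhs D)

PairwiseInequivalent : ∀ {n m} → Formula n m → Set
PairwiseInequivalent {m = m} φ = (j k : Fin m) → Equivalent (φ j) (φ k) → j ≡ k

Homogeneous : ∀ {n m} → Formula n m → Set
Homogeneous {m = m} φ = (j : Fin m) → (s₁ (φ j) ≡ false) × (s₂ (φ j) ≡ false) × (s₃ (φ j) ≡ false)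

litVal : ∀ {n} → (Fin n → Bool) → Fin n → Bool → Bool
litVal a x s = a x xor s

SatClause : ∀ {n} → (Fin n → Bool) → Clause n → Set
SatClause a C = ((litVal a (v₁ C) (s₁ C) xor litVal a (v₂ C) (s₂ C)) xor litVal a (v₃ C) (s₃ C)) ≡ false

Satisfies : ∀ {n m} → (Fin n → Bool) → Formula n m → Set
Satisfies {m = m} a φ = (j : Fin m) → SatClause a (φ j)

UniquelySatisfiable : ∀ {n m} → Formula n m → Set
UniquelySatisfiable {n} φ = (a : Fin n → Bool) → Satisfies a φ → (x : Fin n) → a x ≡ false

-- Index i ∈ {1,…,n-1} is represented by Fin (pred n) (value i-1).
-- lowVar i = X_i, highVar i = X_{i+1}.
lowVar : ∀ {n} → Fin (pred n) → Fin n
lowVar {suc n} i = inject₁ i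

highVar : ∀ {n} → Fin (pred n) → Fin n
highVar {suc n} i = suc i

-- Vertices. cl j t : the four clause vertices of clause j, with
-- t = 0,1,2,3 standing for C₀₀₀, C₀₁₁, C₁₁₀, C₁₀₁.  var x b : X^b.
data Vertex (n m : ℕ) : Set where
  cl : Fin m → Fin 4 → Vertex n m
  var : Fin n → Bool → Vertex n m
  auxL auxR auxS : Fin (pred n) → Vertex n m

flips : Fin 4 → Bool × Bool × Bool
flips zero = false , false , false
flips (suc zero) = false , true , true
flips (suc (suc zero)) = true , true , false
flips (suc (suc (suc zero))) = true , false , true

LitAdj : ∀ {n} → Fin n → Bool → Fin n → Bool → Set
LitAdj y s x b = (x ≡ y) × (b ≡ not s)

ClauseAdj : ∀ {n} → Clause n → Fin 4 → Fin n → Bool → Set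
ClauseAdj C t x b with flips t
... | f₁ , f₂ , f₃ =
  LitAdj (v₁ C) (s₁ C xor f₁) x b ⊎ LitAdj (v₂ C) (s₂ C xor f₂) x b ⊎ LitAdj (v₃ C) (s₃ C xor f₃) x b

-- Directed list of edges of G_φ (each undirected edge listed in one direction).
data Edge {n m : ℕ} (φ : Formula n m) : Vertex n m → Vertex n m → Set where
  e-cl  : (j : Fin m) (t : Fin 4) (x : Fin n) (b : Bool) → ClauseAdj (φ j) t x b → Edge φ (cl j t) (var x b)
  e-var : (x : Fin n) → Edge φ (var x false) (var x true)
  e-lr  : (i : Fin (pred n)) → Edge φ (auxL i) (auxR i)
  e-rs  : (i : Fin (pred n)) → Edge φ (auxR i) (auxS i)
  e-lX  : (i : Fin (pred n)) (b : Bool) → Edge φ (auxL i) (var (lowVar i) b)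
  e-rX  : (i : Fin (pred n)) (b : Bool) → Edge φ (auxR i) (var (highVar i) b)

Adj : ∀ {n m} → Formula n m → Vertex n m → Vertex n m → Set
Adj φ u v = Edge φ u v ⊎ Edge φ v u

IsAutomorphism : ∀ {n m} → Formula n m → (Vertex n m ↔ Vertex n m) → Set
IsAutomorphism {n} {m} φ f =
  (u v : Vertex n m) → Adj φ u v ⇔ Adj φ (Inverse.to f u) (Inverse.to f v)

Asymmetric : ∀ {n m} → Formula n m → Set
Asymmetric {n} {m} φ =
  (f : Vertex n m ↔ Vertex n m) → IsAutomorphism φ f → (u : Vertex n m) → Inverse.to f u ≡ u

-- A solution a of the homogeneous system φ acts on G_φ: it swaps X⁰ and X¹ whenever a(X) = 1,
-- and moves the clause vertex C_p (p the flip pattern) to C_{p ⊕ a|C}; since a has even parity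
-- on every clause, p ⊕ a|C is again one of the four even patterns. A nonzero solution thus gives
-- a nontrivial automorphism.
-- Conversely, the vertices i_s are the only ones with at most one neighbour, and following the
-- path of gadgets i_l, i_r, i_s shows that an automorphism fixes every gadget vertex and maps each
-- pair {X⁰, X¹} to itself, swapping it exactly when a(X) = 1 for some assignment a. A clause
-- vertex is then sent to a clause vertex on the same three variables, hence (clauses being
-- pairwise inequivalent) of the same clause, with pattern shifted by a|C. Parity of the patterns
-- forces a to be a solution, hence zero, and the automorphism is the identity.

module Submission where

open import Defs
open import Data.Nat using (ℕ; zero; suc; pred; _+_; s≤s⁻¹) renaming (_<_ to _<ℕ_)
import Data.Nat.Properties as ℕ
open import Data.Fin using (Fin; zero; suc; toℕ; inject₁; fromℕ; _<_; _≤_)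
open import Data.Fin.Properties using (<⇒≢; toℕ-inject₁; toℕ-injective; toℕ-fromℕ; toℕ<n)
open import Data.Fin.Induction using (<-weakInduction)
open import Data.Bool using (Bool; true; false; not; _xor_)
open import Data.Bool.Properties
  using (xor-∧-commutativeRing; xor-assoc; xor-same; xor-identityʳ; not-distribˡ-xor; not-injective; ¬-not)
open import Algebra.Bundles using (CommutativeRing)
open import Algebra.Properties.CommutativeSemigroup
  (CommutativeRing.+-commutativeSemigroup xor-∧-commutativeRing) using (interchange)
open import Data.Product using (∃; ∃₂; _×_; _,_; proj₁; proj₂)
open import Data.Sum using (_⊎_; inj₁; inj₂)
open import Data.Empty using (⊥; ⊥-elim)
open import Relation.Nullary using (¬_)
open import Relation.Binary.PropositionalEquality
open import Function.Base using (id)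
open import Function.Bundles using (_⇔_; mk⇔; _↔_; mk↔ₛ′; Inverse; Equivalence)

suc-equivariant⇒≗id : ∀ {k} (σ : Fin (suc k) → Fin (suc k)) →
  (∀ (i : Fin k) → toℕ (σ (suc i)) ≡ suc (toℕ (σ (inject₁ i)))) → ∀ i → σ i ≡ i
suc-equivariant⇒≗id {k} σ step i = toℕ-injective (trans (translation i) (cong (_+ toℕ i) σ₀≡0))
  where
  translation : ∀ i → toℕ (σ i) ≡ toℕ (σ zero) + toℕ i
  translation = <-weakInduction _ (sym (ℕ.+-identityʳ _)) λ i ih → begin
    toℕ (σ (suc i))                      ≡⟨ step i ⟩
    suc (toℕ (σ (inject₁ i)))            ≡⟨ cong suc ih ⟩
    suc (toℕ (σ zero) + toℕ (inject₁ i)) ≡⟨ cong (λ x → suc (toℕ (σ zero) + x)) (toℕ-inject₁ i) ⟩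
    suc (toℕ (σ zero) + toℕ i)           ≡⟨ ℕ.+-suc (toℕ (σ zero)) (toℕ i) ⟨
    toℕ (σ zero) + suc (toℕ i)           ∎
    where open ≡-Reasoning
  σ₀≡0 : toℕ (σ zero) ≡ 0
  σ₀≡0 = ℕ.n≤0⇒n≡0 (ℕ.+-cancelʳ-≤ k (toℕ (σ zero)) 0 (s≤s⁻¹ σ₀+k<1+k))
    where
    σ₀+k<1+k : toℕ (σ zero) + k <ℕ suc k
    σ₀+k<1+k = subst (_<ℕ suc k) (trans (translation (fromℕ k)) (cong (toℕ (σ zero) +_) (toℕ-fromℕ k)))
                     (toℕ<n (σ (fromℕ k)))

Pattern : Set
Pattern = Bool × Bool × Bool

infixl 6 _⊕_

_⊕_ : Pattern → Pattern → Pattern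
(p₁ , p₂ , p₃) ⊕ (q₁ , q₂ , q₃) = p₁ xor q₁ , p₂ xor q₂ , p₃ xor q₃

parity : Pattern → Bool
parity (p₁ , p₂ , p₃) = (p₁ xor p₂) xor p₃

parity-⊕ : ∀ p q → parity (p ⊕ q) ≡ parity p xor parity q
parity-⊕ (p₁ , p₂ , p₃) (q₁ , q₂ , q₃) = begin
  ((p₁ xor q₁) xor (p₂ xor q₂)) xor (p₃ xor q₃)
    ≡⟨ cong (_xor (p₃ xor q₃)) (interchange p₁ q₁ p₂ q₂) ⟩
  ((p₁ xor p₂) xor (q₁ xor q₂)) xor (p₃ xor q₃)
    ≡⟨ interchange (p₁ xor p₂) (q₁ xor q₂) p₃ q₃ ⟩
  ((p₁ xor p₂) xor p₃) xor ((q₁ xor q₂) xor q₃) ∎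
  where open ≡-Reasoning

xor-cancelʳ : ∀ x y → (x xor y) xor y ≡ x
xor-cancelʳ x y = trans (xor-assoc x y y) (trans (cong (x xor_) (xor-same y)) (xor-identityʳ x))

xor-injectiveʳ : ∀ x {y z} → x xor y ≡ x xor z → y ≡ z
xor-injectiveʳ false e = e
xor-injectiveʳ true e = not-injective e

⊕-cancelʳ : ∀ p q → p ⊕ q ⊕ q ≡ p
⊕-cancelʳ (p₁ , p₂ , p₃) (q₁ , q₂ , q₃) =
  cong₂ _,_ (xor-cancelʳ p₁ q₁) (cong₂ _,_ (xor-cancelʳ p₂ q₂) (xor-cancelʳ p₃ q₃))

⊕-identityʳ : ∀ p → p ⊕ (false , false , false) ≡ p
⊕-identityʳ (p₁ , p₂ , p₃) =
  cong₂ _,_ (xor-identityʳ p₁) (cong₂ _,_ (xor-identityʳ p₂) (xor-identityʳ p₃))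

-- Inverse of flips on patterns of even parity, which are determined by their first two entries.
flipIndex : Pattern → Fin 4
flipIndex (false , false , _) = zero
flipIndex (false , true  , _) = suc zero
flipIndex (true  , true  , _) = suc (suc zero)
flipIndex (true  , false , _) = suc (suc (suc zero))

flips-flipIndex : ∀ p → parity p ≡ false → flips (flipIndex p) ≡ p
flips-flipIndex (false , false , false) _ = refl
flips-flipIndex (false , true  , true)  _ = refl
flips-flipIndex (true  , true  , false) _ = refl
flips-flipIndex (true  , false , true)  _ = refl
flips-flipIndex (false , false , true)  ()
flips-flipIndex (false , true  , false) ()
flips-flipIndex (true  , true  , true)  ()
flips-flipIndex (true  , false , false) ()

flipIndex-flips : ∀ t → flipIndex (flips t) ≡ t
flipIndex-flips zero = refl
flipIndex-flips (suc zero) = refl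
flipIndex-flips (suc (suc zero)) = refl
flipIndex-flips (suc (suc (suc zero))) = refl

parity-flips : ∀ t → parity (flips t) ≡ false
parity-flips zero = refl
parity-flips (suc zero) = refl
parity-flips (suc (suc zero)) = refl
parity-flips (suc (suc (suc zero))) = refl

flips-injective : ∀ {t t'} → flips t ≡ flips t' → t ≡ t'
flips-injective {t} {t'} e = trans (sym (flipIndex-flips t)) (trans (cong flipIndex e) (flipIndex-flips t'))

not-xor-shift : ∀ s f c → not (s xor f) xor c ≡ not (s xor (f xor c))
not-xor-shift s f c = begin
  not (s xor f) xor c   ≡⟨ cong (_xor c) (not-distribˡ-xor s f) ⟩
  (not s xor f) xor c   ≡⟨ xor-assoc (not s) f c ⟩
  not s xor (f xor c)   ≡⟨ not-distribˡ-xor s (f xor c) ⟨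
  not (s xor (f xor c)) ∎
  where open ≡-Reasoning

not-xor-shift⁻ : ∀ s f c {f'} → not (s xor f) xor c ≡ not (s xor f') → f' ≡ f xor c
not-xor-shift⁻ s f c e = sym (xor-injectiveʳ s (not-injective (trans (sym (not-xor-shift s f c)) e)))

values : ∀ {n} → (Fin n → Bool) → Clause n → Pattern
values a C = a (v₁ C) , a (v₂ C) , a (v₃ C)

signs : ∀ {n} → Clause n → Pattern
signs C = s₁ C , s₂ C , s₃ C

rhs≡false : ∀ {n} {C : Clause n} → s₁ C ≡ false × s₂ C ≡ false × s₃ C ≡ false → rhs C ≡ false
rhs≡false (refl , refl , refl) = refl

SatClause⇔parity≡false : ∀ {n} (a : Fin n → Bool) (C : Clause n) → rhs C ≡ false →
                         SatClause a C ⇔ parity (values a C) ≡ false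
SatClause⇔parity≡false a C rhs≡0 = mk⇔ (λ sat → trans (sym sum≡) sat) (λ even → trans sum≡ even)
  where
  -- SatClause a C unfolds to parity (values a C ⊕ signs C) ≡ false.
  sum≡ : parity (values a C ⊕ signs C) ≡ parity (values a C)
  sum≡ = trans (parity-⊕ (values a C) (signs C))
               (trans (cong (parity (values a C) xor_) rhs≡0) (xor-identityʳ _))

_∈vars_ : ∀ {n} → Fin n → Clause n → Set
x ∈vars C = x ≡ v₁ C ⊎ x ≡ v₂ C ⊎ x ≡ v₃ C

module _ {n} (C : Clause n) where

  v₁<v₃ : v₁ C < v₃ C
  v₁<v₃ = ℕ.<-trans (v₁<v₂ C) (v₂<v₃ C)

  ∈vars⇒v₁≤ : ∀ {x} → x ∈vars C → v₁ C ≤ x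
  ∈vars⇒v₁≤ (inj₁ refl) = ℕ.≤-refl
  ∈vars⇒v₁≤ (inj₂ (inj₁ refl)) = ℕ.<⇒≤ (v₁<v₂ C)
  ∈vars⇒v₁≤ (inj₂ (inj₂ refl)) = ℕ.<⇒≤ v₁<v₃

  ∈vars⇒≤v₃ : ∀ {x} → x ∈vars C → x ≤ v₃ C
  ∈vars⇒≤v₃ (inj₁ refl) = ℕ.<⇒≤ v₁<v₃
  ∈vars⇒≤v₃ (inj₂ (inj₁ refl)) = ℕ.<⇒≤ (v₂<v₃ C)
  ∈vars⇒≤v₃ (inj₂ (inj₂ refl)) = ℕ.≤-refl

  ∈vars-below-v₂ : ∀ {x} → x ∈vars C → x < v₂ C → x ≡ v₁ C
  ∈vars-below-v₂ (inj₁ e) _ = e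
  ∈vars-below-v₂ (inj₂ (inj₁ refl)) x<x = ⊥-elim (ℕ.<-irrefl refl x<x)
  ∈vars-below-v₂ (inj₂ (inj₂ refl)) x<v₂ = ⊥-elim (ℕ.<-asym x<v₂ (v₂<v₃ C))

  ∈vars-above-v₂ : ∀ {x} → x ∈vars C → v₂ C < x → x ≡ v₃ C
  ∈vars-above-v₂ (inj₁ refl) v₂<x = ⊥-elim (ℕ.<-asym v₂<x (v₁<v₂ C))
  ∈vars-above-v₂ (inj₂ (inj₁ refl)) x<x = ⊥-elim (ℕ.<-irrefl refl x<x)
  ∈vars-above-v₂ (inj₂ (inj₂ e)) _ = e

vars-⊆⇒≡ : ∀ {n} (C D : Clause n) → v₁ C ∈vars D → v₂ C ∈vars D → v₃ C ∈vars D →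
           v₁ C ≡ v₁ D × v₂ C ≡ v₂ D × v₃ C ≡ v₃ D
vars-⊆⇒≡ C D x∈ y∈ z∈ with y∈
... | inj₁ y≡ = ⊥-elim (ℕ.<⇒≱ (v₁<v₂ C) (subst (_≤ v₁ C) (sym y≡) (∈vars⇒v₁≤ D x∈)))
... | inj₂ (inj₂ y≡) = ⊥-elim (ℕ.<⇒≱ (v₂<v₃ C) (subst (v₃ C ≤_) (sym y≡) (∈vars⇒≤v₃ D z∈)))
... | inj₂ (inj₁ y≡) =
  ∈vars-below-v₂ D x∈ (subst (v₁ C <_) y≡ (v₁<v₂ C)) , y≡ ,
  ∈vars-above-v₂ D z∈ (subst (_< v₃ C) y≡ (v₂<v₃ C))

FlippedAdj : ∀ {n} → Clause n → Pattern → Fin n → Bool → Set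
FlippedAdj C (f₁ , f₂ , f₃) x b =
  LitAdj (v₁ C) (s₁ C xor f₁) x b ⊎ LitAdj (v₂ C) (s₂ C xor f₂) x b ⊎ LitAdj (v₃ C) (s₃ C xor f₃) x b

ClauseAdj≡FlippedAdj : ∀ {n} (C : Clause n) t x b → ClauseAdj C t x b ≡ FlippedAdj C (flips t) x b
ClauseAdj≡FlippedAdj C zero x b = refl
ClauseAdj≡FlippedAdj C (suc zero) x b = refl
ClauseAdj≡FlippedAdj C (suc (suc zero)) x b = refl
ClauseAdj≡FlippedAdj C (suc (suc (suc zero))) x b = refl

module _ {n} (C : Clause n) where

  FlippedAdj-shift : ∀ (a : Fin n → Bool) p {x b} →
                     FlippedAdj C p x b → FlippedAdj C (p ⊕ values a C) x (b xor a x)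
  FlippedAdj-shift a (f₁ , _ , _) (inj₁ (refl , refl)) = inj₁ (refl , not-xor-shift (s₁ C) f₁ _)
  FlippedAdj-shift a (_ , f₂ , _) (inj₂ (inj₁ (refl , refl))) = inj₂ (inj₁ (refl , not-xor-shift (s₂ C) f₂ _))
  FlippedAdj-shift a (_ , _ , f₃) (inj₂ (inj₂ (refl , refl))) = inj₂ (inj₂ (refl , not-xor-shift (s₃ C) f₃ _))

  FlippedAdj⇒∈vars : ∀ {p x b} → FlippedAdj C p x b → x ∈vars C
  FlippedAdj⇒∈vars (inj₁ (e , _)) = inj₁ e
  FlippedAdj⇒∈vars (inj₂ (inj₁ (e , _))) = inj₂ (inj₁ e)
  FlippedAdj⇒∈vars (inj₂ (inj₂ (e , _))) = inj₂ (inj₂ e)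

  FlippedAdj-v₁ : ∀ {p b} → FlippedAdj C p (v₁ C) b → b ≡ not (s₁ C xor proj₁ p)
  FlippedAdj-v₁ (inj₁ (_ , e)) = e
  FlippedAdj-v₁ (inj₂ (inj₁ (e , _))) = ⊥-elim (<⇒≢ (v₁<v₂ C) e)
  FlippedAdj-v₁ (inj₂ (inj₂ (e , _))) = ⊥-elim (<⇒≢ (v₁<v₃ C) e)

  FlippedAdj-v₂ : ∀ {p b} → FlippedAdj C p (v₂ C) b → b ≡ not (s₂ C xor proj₁ (proj₂ p))
  FlippedAdj-v₂ (inj₁ (e , _)) = ⊥-elim (<⇒≢ (v₁<v₂ C) (sym e))
  FlippedAdj-v₂ (inj₂ (inj₁ (_ , e))) = e
  FlippedAdj-v₂ (inj₂ (inj₂ (e , _))) = ⊥-elim (<⇒≢ (v₂<v₃ C) e)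

  FlippedAdj-v₃ : ∀ {p b} → FlippedAdj C p (v₃ C) b → b ≡ not (s₃ C xor proj₂ (proj₂ p))
  FlippedAdj-v₃ (inj₁ (e , _)) = ⊥-elim (<⇒≢ (v₁<v₃ C) (sym e))
  FlippedAdj-v₃ (inj₂ (inj₁ (e , _))) = ⊥-elim (<⇒≢ (v₂<v₃ C) (sym e))
  FlippedAdj-v₃ (inj₂ (inj₂ (_ , e))) = e

  FlippedAdj-shift⁻ : ∀ (a : Fin n → Bool) p p' →
    (∀ {x b} → FlippedAdj C p x b → FlippedAdj C p' x (b xor a x)) → p' ≡ p ⊕ values a C
  FlippedAdj-shift⁻ a (f₁ , f₂ , f₃) p' shifted =
    cong₂ _,_ (not-xor-shift⁻ (s₁ C) f₁ _ (FlippedAdj-v₁ (shifted (inj₁ (refl , refl)))))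
      (cong₂ _,_ (not-xor-shift⁻ (s₂ C) f₂ _ (FlippedAdj-v₂ (shifted (inj₂ (inj₁ (refl , refl))))))
                 (not-xor-shift⁻ (s₃ C) f₃ _ (FlippedAdj-v₃ (shifted (inj₂ (inj₂ (refl , refl)))))))

cl-var⇔ : ∀ {n m} (φ : Formula n m) {j t x b} → Adj φ (cl j t) (var x b) ⇔ FlippedAdj (φ j) (flips t) x b
cl-var⇔ φ {j} {t} {x} {b} = mk⇔ to (λ adj → inj₁ (e-cl j t x b (subst id (sym ClauseAdj≡) adj)))
  where
  ClauseAdj≡ : ClauseAdj (φ j) t x b ≡ FlippedAdj (φ j) (flips t) x b
  ClauseAdj≡ = ClauseAdj≡FlippedAdj (φ j) t x b
  to : Adj φ (cl j t) (var x b) → FlippedAdj (φ j) (flips t) x b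
  to (inj₁ (e-cl _ _ _ _ adj)) = subst id ClauseAdj≡ adj

var-injective : ∀ {n m} {x y : Fin n} {b c} → var {n} {m} x b ≡ var y c → x ≡ y × b ≡ c
var-injective refl = refl , refl

lowVar≢highVar : ∀ {n} (i : Fin (pred n)) → lowVar {n} i ≢ highVar i
lowVar≢highVar {suc n} i = <⇒≢ (ℕ.≤-reflexive (cong suc (toℕ-inject₁ i)))

module _ {n m} {φ : Formula n m} where

  shiftedNeighbourhood⊆⇒≡ : (∀ j → rhs (φ j) ≡ false) → PairwiseInequivalent φ →
    ∀ (a : Fin n → Bool) {j j' p p'} →
    (∀ {x b} → FlippedAdj (φ j) p x b → FlippedAdj (φ j') p' x (b xor a x)) →
    j ≡ j' × p' ≡ p ⊕ values a (φ j)
  shiftedNeighbourhood⊆⇒≡ homogeneous inequivalent a {j} {j'} {p} {p'} shifted =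
    j≡j' , FlippedAdj-shift⁻ (φ j) a p p' (λ adj → subst (λ k → FlippedAdj (φ k) p' _ _) (sym j≡j') (shifted adj))
    where
    ∈φj' : ∀ {x b} → FlippedAdj (φ j) p x b → x ∈vars φ j'
    ∈φj' adj = FlippedAdj⇒∈vars (φ j') (shifted adj)
    sameVars : v₁ (φ j) ≡ v₁ (φ j') × v₂ (φ j) ≡ v₂ (φ j') × v₃ (φ j) ≡ v₃ (φ j')
    sameVars = vars-⊆⇒≡ (φ j) (φ j') (∈φj' (inj₁ (refl , refl))) (∈φj' (inj₂ (inj₁ (refl , refl))))
                        (∈φj' (inj₂ (inj₂ (refl , refl))))
    j≡j' : j ≡ j'
    j≡j' = inequivalent j j'
      (proj₁ sameVars , proj₁ (proj₂ sameVars) , proj₂ (proj₂ sameVars) , trans (homogeneous j) (sym (homogeneous j')))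

  Adj-sym : ∀ {u v} → Adj φ u v → Adj φ v u
  Adj-sym (inj₁ e) = inj₂ e
  Adj-sym (inj₂ e) = inj₁ e

  var-partner : ∀ x b → Adj φ (var x b) (var x (not b))
  var-partner x false = inj₁ (e-var x)
  var-partner x true = inj₂ (e-var x)

  auxS-neighbour : ∀ {i w} → Adj φ (auxS i) w → w ≡ auxR i
  auxS-neighbour (inj₂ (e-rs _)) = refl

  auxR-neighbour : ∀ {i w} → Adj φ (auxR i) w →
                   w ≡ auxL i ⊎ w ≡ auxS i ⊎ ∃ λ b → w ≡ var (highVar i) b
  auxR-neighbour (inj₁ (e-rs _)) = inj₂ (inj₁ refl)
  auxR-neighbour (inj₁ (e-rX _ b)) = inj₂ (inj₂ (b , refl))
  auxR-neighbour (inj₂ (e-lr _)) = inj₁ refl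

  auxL-neighbour : ∀ {i w} → Adj φ (auxL i) w → w ≡ auxR i ⊎ ∃ λ b → w ≡ var (lowVar i) b
  auxL-neighbour (inj₁ (e-lr _)) = inj₁ refl
  auxL-neighbour (inj₁ (e-lX _ b)) = inj₂ (b , refl)

  auxL-auxR-noCommonNeighbour : ∀ {i w} → Adj φ (auxL i) w → Adj φ (auxR i) w → ⊥
  auxL-auxR-noCommonNeighbour adjL adjR with auxL-neighbour adjL | auxR-neighbour adjR
  ... | inj₁ refl | inj₁ ()
  ... | inj₁ refl | inj₂ (inj₁ ())
  ... | inj₁ refl | inj₂ (inj₂ (_ , ()))
  ... | inj₂ (_ , refl) | inj₁ ()
  ... | inj₂ (_ , refl) | inj₂ (inj₁ ())
  ... | inj₂ (_ , refl) | inj₂ (inj₂ (_ , e)) = lowVar≢highVar _ (proj₁ (var-injective e))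

AtMostOneNeighbour : ∀ {n m} → Formula n m → Vertex n m → Set
AtMostOneNeighbour φ v = ∀ {w w'} → Adj φ v w → Adj φ v w' → w ≡ w'

auxS-atMostOneNeighbour : ∀ {n m} {φ : Formula n m} i → AtMostOneNeighbour φ (auxS i)
auxS-atMostOneNeighbour i adj adj' = trans (auxS-neighbour adj) (sym (auxS-neighbour adj'))

-- With at least two variables every variable vertex has an auxiliary neighbour.
atMostOneNeighbour⇒auxS : ∀ {k m} {φ : Formula (suc (suc k)) m} v →
                          AtMostOneNeighbour φ v → ∃ λ i → v ≡ auxS i
atMostOneNeighbour⇒auxS {φ = φ} (cl j t) one =
  ⊥-elim (<⇒≢ (v₁<v₂ (φ j)) (proj₁ (var-injective (one (literal (inj₁ (refl , refl)))
                                                        (literal (inj₂ (inj₁ (refl , refl))))))))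
  where
  literal : ∀ {x b} → FlippedAdj (φ j) (flips t) x b → Adj φ (cl j t) (var x b)
  literal = Equivalence.from (cl-var⇔ φ)
atMostOneNeighbour⇒auxS (var zero b) one with one (var-partner zero b) (inj₂ (e-lX zero b))
... | ()
atMostOneNeighbour⇒auxS (var (suc i) b) one with one (var-partner (suc i) b) (inj₂ (e-rX i b))
... | ()
atMostOneNeighbour⇒auxS (auxL i) one with one (inj₁ (e-lr i)) (inj₁ (e-lX i false))
... | ()
atMostOneNeighbour⇒auxS (auxR i) one with one (inj₂ (e-lr i)) (inj₁ (e-rs i))
... | ()
atMostOneNeighbour⇒auxS (auxS i) _ = i , refl

module Flip {n m} (φ : Formula n m) (a : Fin n → Bool) (even : ∀ j → parity (values a (φ j)) ≡ false) where

  shift : Fin m → Fin 4 → Fin 4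
  shift j t = flipIndex (flips t ⊕ values a (φ j))

  flips-shift : ∀ j t → flips (shift j t) ≡ flips t ⊕ values a (φ j)
  flips-shift j t = flips-flipIndex _
    (trans (parity-⊕ (flips t) (values a (φ j))) (cong₂ _xor_ (parity-flips t) (even j)))

  flip : Vertex n m → Vertex n m
  flip (cl j t) = cl j (shift j t)
  flip (var x b) = var x (b xor a x)
  flip (auxL i) = auxL i
  flip (auxR i) = auxR i
  flip (auxS i) = auxS i

  flip-involutive : ∀ u → flip (flip u) ≡ u
  flip-involutive (cl j t) = cong (cl j) (flips-injective (begin
    flips (shift j (shift j t))                      ≡⟨ flips-shift j (shift j t) ⟩
    flips (shift j t) ⊕ values a (φ j)               ≡⟨ cong (_⊕ values a (φ j)) (flips-shift j t) ⟩
    flips t ⊕ values a (φ j) ⊕ values a (φ j)        ≡⟨ ⊕-cancelʳ (flips t) (values a (φ j)) ⟩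
    flips t                                          ∎))
    where open ≡-Reasoning
  flip-involutive (var x b) = cong (var x) (xor-cancelʳ b (a x))
  flip-involutive (auxL i) = refl
  flip-involutive (auxR i) = refl
  flip-involutive (auxS i) = refl

  flip-edge : ∀ {u v} → Edge φ u v → Adj φ (flip u) (flip v)
  flip-edge (e-cl j t x b adj) = Equivalence.from (cl-var⇔ φ)
    (subst (λ p → FlippedAdj (φ j) p x (b xor a x)) (sym (flips-shift j t))
      (FlippedAdj-shift (φ j) a (flips t) (Equivalence.to (cl-var⇔ φ) (inj₁ (e-cl j t x b adj)))))
  flip-edge (e-var x) = var-partner x (a x)
  flip-edge (e-lr i) = inj₁ (e-lr i)
  flip-edge (e-rs i) = inj₁ (e-rs i)
  flip-edge (e-lX i b) = inj₁ (e-lX i _)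
  flip-edge (e-rX i b) = inj₁ (e-rX i _)

  flip-adj : ∀ {u v} → Adj φ u v → Adj φ (flip u) (flip v)
  flip-adj (inj₁ e) = flip-edge e
  flip-adj (inj₂ e) = Adj-sym (flip-edge e)

  flip-↔ : Vertex n m ↔ Vertex n m
  flip-↔ = mk↔ₛ′ flip flip flip-involutive flip-involutive

  flip-automorphism : IsAutomorphism φ flip-↔
  flip-automorphism u v =
    mk⇔ flip-adj (λ adj → subst₂ (Adj φ) (flip-involutive u) (flip-involutive v) (flip-adj adj))

module Automorphism {n m} {φ : Formula n m} (f : Vertex n m ↔ Vertex n m) (aut : IsAutomorphism φ f) where

  open Inverse f public using (to; from; strictlyInverseˡ; strictlyInverseʳ)

  to-injective : ∀ {u v} → to u ≡ to v → u ≡ v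
  to-injective {u} {v} e = trans (sym (strictlyInverseʳ u)) (trans (cong from e) (strictlyInverseʳ v))

  adj : ∀ {u v u' v'} → to u ≡ u' → to v ≡ v' → Adj φ u v → Adj φ u' v'
  adj refl refl = Equivalence.to (aut _ _)

  adj⁻ : ∀ {u w} → Adj φ (to u) w → Adj φ u (from w)
  adj⁻ {u} {w} h = Equivalence.from (aut u (from w)) (subst (Adj φ (to u)) (sym (strictlyInverseˡ w)) h)

  atMostOneNeighbour-to : ∀ {v} → AtMostOneNeighbour φ v → AtMostOneNeighbour φ (to v)
  atMostOneNeighbour-to one {w} {w'} h h' =
    trans (sym (strictlyInverseˡ w)) (trans (cong to (one (adj⁻ h) (adj⁻ h'))) (strictlyInverseˡ w'))

module Rigidity {k m} {φ : Formula (suc (suc k)) m} (f : Vertex (suc (suc k)) m ↔ Vertex (suc (suc k)) m)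
                (aut : IsAutomorphism φ f) where

  open Automorphism f aut

  private
    auxS-image : ∀ i → ∃ λ i' → to (auxS i) ≡ auxS i'
    auxS-image i = atMostOneNeighbour⇒auxS (to (auxS i)) (atMostOneNeighbour-to (auxS-atMostOneNeighbour i))

  σ : Fin (suc k) → Fin (suc k)
  σ i = proj₁ (auxS-image i)

  to-auxS : ∀ i → to (auxS i) ≡ auxS (σ i)
  to-auxS i = proj₂ (auxS-image i)

  to-auxR : ∀ i → to (auxR i) ≡ auxR (σ i)
  to-auxR i = auxS-neighbour (adj (to-auxS i) refl (inj₂ (e-rs i)))

  to-auxL : ∀ i → to (auxL i) ≡ auxL (σ i)
  to-auxL i with auxR-neighbour (adj (to-auxR i) refl (inj₂ (e-lr i)))
  ... | inj₁ e = e
  ... | inj₂ (inj₁ e) with () ← to-injective (trans e (sym (to-auxS i)))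
  ... | inj₂ (inj₂ (b , e)) = ⊥-elim (auxL-auxR-noCommonNeighbour (adj⁻ adjL) (adj⁻ adjR))
    where
    -- the partner of that variable vertex would be a common neighbour of the images of auxL i and auxR i
    partner : Vertex (suc (suc k)) m
    partner = var (highVar (σ i)) (not b)
    adjL : Adj φ (to (auxL i)) partner
    adjL = subst (λ v → Adj φ v partner) (sym e) (var-partner _ b)
    adjR : Adj φ (to (auxR i)) partner
    adjR = subst (λ v → Adj φ v partner) (sym (to-auxR i)) (inj₁ (e-rX _ (not b)))

  to-lowVar : ∀ i b → ∃ λ b' → to (var (lowVar i) b) ≡ var (lowVar (σ i)) b'
  to-lowVar i b with auxL-neighbour (adj (to-auxL i) refl (inj₁ (e-lX i b)))
  ... | inj₁ e with () ← to-injective (trans e (sym (to-auxR i)))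
  ... | inj₂ image = image

  to-highVar : ∀ i b → ∃ λ b' → to (var (highVar i) b) ≡ var (highVar (σ i)) b'
  to-highVar i b with auxR-neighbour (adj (to-auxR i) refl (inj₁ (e-rX i b)))
  ... | inj₁ e with () ← to-injective (trans e (sym (to-auxL i)))
  ... | inj₂ (inj₁ e) with () ← to-injective (trans e (sym (to-auxS i)))
  ... | inj₂ (inj₂ image) = image

  -- X_{i+1} is both the high variable of i and the low variable of i + 1.
  σ-step : ∀ (i : Fin k) → toℕ (σ (suc i)) ≡ suc (toℕ (σ (inject₁ i)))
  σ-step i = trans (sym (toℕ-inject₁ (σ (suc i)))) (cong toℕ (proj₁ (var-injective same)))
    where
    same : var (lowVar (σ (suc i))) _ ≡ var (highVar (σ (inject₁ i))) _
    same = trans (sym (proj₂ (to-lowVar (suc i) false))) (proj₂ (to-highVar (inject₁ i) false))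

  σ≗id : ∀ i → σ i ≡ i
  σ≗id = suc-equivariant⇒≗id σ σ-step

  to-auxS-fixed : ∀ i → to (auxS i) ≡ auxS i
  to-auxS-fixed i = trans (to-auxS i) (cong auxS (σ≗id i))

  to-auxR-fixed : ∀ i → to (auxR i) ≡ auxR i
  to-auxR-fixed i = trans (to-auxR i) (cong auxR (σ≗id i))

  to-auxL-fixed : ∀ i → to (auxL i) ≡ auxL i
  to-auxL-fixed i = trans (to-auxL i) (cong auxL (σ≗id i))

  private
    to-var-pair : ∀ x b → ∃ λ b' → to (var x b) ≡ var x b'
    to-var-pair zero b = subst (λ i → ∃ λ b' → to (var zero b) ≡ var (lowVar i) b') (σ≗id zero) (to-lowVar zero b)
    to-var-pair (suc i) b = subst (λ i' → ∃ λ b' → to (var (suc i) b) ≡ var (highVar i') b') (σ≗id i) (to-highVar i b)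

  bit : Fin (suc (suc k)) → Bool
  bit x = proj₁ (to-var-pair x false)

  to-var : ∀ x b → to (var x b) ≡ var x (b xor bit x)
  to-var x false = proj₂ (to-var-pair x false)
  to-var x true = trans image (cong (var x) (¬-not image≢bit))
    where
    image : to (var x true) ≡ var x (proj₁ (to-var-pair x true))
    image = proj₂ (to-var-pair x true)
    image≢bit : proj₁ (to-var-pair x true) ≢ bit x
    image≢bit same with () ← to-injective (trans image (trans (cong (var x) same) (sym (to-var x false))))

  to-cl : ∀ j t → ∃₂ λ j' t' → to (cl j t) ≡ cl j' t'
  to-cl j t with to (cl j t) in eq
  ... | cl j' t' = j' , t' , refl
  ... | var x b with () ← to-injective (trans eq (sym (trans (to-var x (b xor bit x))
                                                             (cong (var x) (xor-cancelʳ b (bit x))))))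
  ... | auxL i with () ← to-injective (trans eq (sym (to-auxL-fixed i)))
  ... | auxR i with () ← to-injective (trans eq (sym (to-auxR-fixed i)))
  ... | auxS i with () ← to-injective (trans eq (sym (to-auxS-fixed i)))

  module _ (homogeneous : ∀ j → rhs (φ j) ≡ false) (inequivalent : PairwiseInequivalent φ) where

    to-cl-shift : ∀ {j t j' t'} → to (cl j t) ≡ cl j' t' → j ≡ j' × flips t' ≡ flips t ⊕ values bit (φ j)
    to-cl-shift e = shiftedNeighbourhood⊆⇒≡ {φ = φ} homogeneous inequivalent bit
      (λ adjC → Equivalence.to (cl-var⇔ φ) (adj e (to-var _ _) (Equivalence.from (cl-var⇔ φ) adjC)))

    bit-even : ∀ j → parity (values bit (φ j)) ≡ false
    bit-even j with to-cl j zero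
    ... | _ , t' , e = trans (cong parity (sym (proj₂ (to-cl-shift e)))) (parity-flips t')

    bit≡false⇒to≗id : (∀ x → bit x ≡ false) → ∀ u → to u ≡ u
    bit≡false⇒to≗id bit≡false (cl j t) with to-cl j t
    ... | j' , t' , e with to-cl-shift e
    ...   | refl , flips≡ = trans e (cong (cl j) (flips-injective (begin
      flips t'                                      ≡⟨ flips≡ ⟩
      flips t ⊕ values bit (φ j)                    ≡⟨ cong (λ p → flips t ⊕ p) values≡0 ⟩
      flips t ⊕ (false , false , false)             ≡⟨ ⊕-identityʳ (flips t) ⟩
      flips t                                       ∎)))
      where
      open ≡-Reasoning
      values≡0 : values bit (φ j) ≡ (false , false , false)
      values≡0 = cong₂ _,_ (bit≡false (v₁ (φ j))) (cong₂ _,_ (bit≡false (v₂ (φ j))) (bit≡false (v₃ (φ j))))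
    bit≡false⇒to≗id bit≡false (var x b) = trans (to-var x b) (cong (var x) (trans (cong (b xor_) (bit≡false x)) (xor-identityʳ b)))
    bit≡false⇒to≗id _ (auxL i) = to-auxL-fixed i
    bit≡false⇒to≗id _ (auxR i) = to-auxR-fixed i
    bit≡false⇒to≗id _ (auxS i) = to-auxS-fixed i

¬Clause1 : ¬ Clause 1
¬Clause1 (clause zero zero _ _ _ _ () _)

asymmetric⇒uniquelySatisfiable : ∀ {n m} {φ : Formula n m} → (∀ j → rhs (φ j) ≡ false) →
                                 Asymmetric φ → UniquelySatisfiable φ
asymmetric⇒uniquelySatisfiable {φ = φ} homogeneous asymmetric a sat x =
  proj₂ (var-injective (asymmetric flip-↔ flip-automorphism (var x false)))
  where
  open Flip φ a (λ j → Equivalence.to (SatClause⇔parity≡false a (φ j) (homogeneous j)) (sat j))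

uniquelySatisfiable⇒asymmetric : ∀ n {m} {φ : Formula n m} → (∀ j → rhs (φ j) ≡ false) →
                                 PairwiseInequivalent φ → UniquelySatisfiable φ → Asymmetric φ
uniquelySatisfiable⇒asymmetric zero {φ = φ} _ _ _ _ _ (cl j t) with v₁ (φ j)
... | ()
-- A single variable occurs in no clause, so setting it to true satisfies φ.
uniquelySatisfiable⇒asymmetric (suc zero) {φ = φ} _ _ unique
  with () ← unique (λ _ → true) (λ j → ⊥-elim (¬Clause1 (φ j))) zero
uniquelySatisfiable⇒asymmetric (suc (suc k)) {φ = φ} homogeneous inequivalent unique f aut =
  bit≡false⇒to≗id homogeneous inequivalent
    (unique bit (λ j → Equivalence.from (SatClause⇔parity≡false bit (φ j) (homogeneous j)) (bit-even homogeneous inequivalent j)))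
  where open Rigidity f aut

lemma3 : (n m : ℕ) (φ : Formula n m) → Homogeneous φ → PairwiseInequivalent φ →
           UniquelySatisfiable φ ⇔ Asymmetric φ
lemma3 n m φ hom inequivalent =
  mk⇔ (uniquelySatisfiable⇒asymmetric n homogeneous inequivalent) (asymmetric⇒uniquelySatisfiable homogeneous)
  where
  homogeneous : ∀ j → rhs (φ j) ≡ false
  homogeneous j = rhs≡false {C = φ j} (hom j)
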